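{- Let $\mathcal{A}$ be an axiom system from which the five formulas $\langle T\in D\rangle$ and $[\,\mathcal{A}\vdash\langle T\le d\rangle\,]\to\langle T\neq d\rangle$ for $d\in\{\mathrm{Tu},\mathrm{We},\mathrm{Th},\mathrm{Fr}\}$ are all provable. Then $D^{\mathcal{A}}_{\mathrm{surpr}}=\emptyset$, i.e., no $d\in D$ satisfies $d\models\sigma^{\mathcal{A}}$.
   Context: Let $R=\{\mathrm{Mo},\mathrm{Tu},\mathrm{We},\mathrm{Th},\mathrm{Fr},\mathrm{none}\}$ be linearly ordered by $\mathrm{Mo}<\mathrm{Tu}<\mathrm{We}<\mathrm{Th}<\mathrm{Fr}<\mathrm{none}$, and $D=\{\mathrm{Mo},\dots,\mathrm{Fr}\}$. Propositional formulas are built from atoms $Y_r$ ($r\in R$) with $\bot,\to$ (usual derived connectives, $\top:=\neg\bot$). The axiom $(\mathrm{Ax}_{=1})$ is $\bigvee_{r\in R}Y_r\wedge\bigwedge_{r<s}(\neg Y_r\vee\neg Y_s)$. Its models are identified with the elements of $R$ ($r$ makes exactly $Y_r$ true); $r\models\varphi$ means $\varphi$ is true in $r$. An axiom system $\mathcal{A}$ is a set of formulas always containing $(\mathrm{Ax}_{=1})$; $\mathcal{A}\vdash\varphi$ is propositional provability (equivalently, $\varphi$ holds in every $r\in R$ satisfying $\mathcal{A}$). For $B\subseteq R$: $\langle T\in B\rangle:=\bigvee_{r\in B}Y_r$, $\langle T\le d\rangle:=\langle T\in\{r:r\le d\}\rangle$, $\langle T=r\rangle:=Y_r$, $\langle T\neq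 r\rangle:=\neg Y_r$. $K\subseteq R$ is an $\mathcal{A}$-p-knowledge set if $\mathcal{A}\vdash\langle T\in K\rangle$; $K_{\mathcal{A}}$ is the intersection of all of them. $d\in D$ is $\mathcal{A}$-p-surprising if $d\in K_{\mathcal{A}}$ and $\mathcal{A}\nvdash\langle T\le d\rangle$; $D^{\mathcal{A}}_{\mathrm{surpr}}$ is the set of these. Iverson brackets: $[S]$ is $\top$ if the assertion $S$ is true, $\bot$ otherwise. $\sigma^{\mathcal{A}}:=\bigwedge_{K\subseteq R}\bigl([K_{\mathcal{A}}\subseteq K]\to\langle T\in K-\{\max K\}\rangle\bigr)$, with $\emptyset-\{\max\emptyset\}=\emptyset$. -}

module Defs where

open import Data.Nat using (ℕ; zero; suc; _≤?_; _<?_)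
open import Data.Fin using (Fin; toℕ; inject₁)
open import Data.Fin.Properties using () renaming (_<?_ to _<ᶠ?_)
open import Data.Bool using (Bool; true; false; if_then_else_; _∨_)
open import Data.Vec using (Vec; []; _∷_; lookup; tabulate)
open import Data.List using (List; []; _∷_; map; concatMap; _++_)
open import Data.List.Base using (allFin)
open import Data.Product using (Σ; Σ-syntax; _×_)
open import Relation.Nullary using (¬_)
open import Relation.Nullary.Decidable using (⌊_⌋)
open import Relation.Binary.PropositionalEquality using (_≡_)
import Data.Empty as E

-- R = {Mo,Tu,We,Th,Fr,none} as Fin 6 (Mo = 0, …, none = 5), ordered by toℕ.
R : Set
R = Fin 6

-- D = {Mo,…,Fr}, represented by Fin 5 and embedded via inject₁.
Day : Set
Day = Fin 5

day : Day → R
day = inject₁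

SubR : Set
SubR = Vec Bool 6

_∈R_ : R → SubR → Set
r ∈R K = lookup K r ≡ true

-- Propositional formulas over atoms Y_r, with ⊥ and →, plus Iverson brackets
-- ⟦ S ⟧ (the formula ⊤ if S holds and ⊥ otherwise).
data Formula : Set₁ where
  Y   : R → Formula
  ⊥'  : Formula
  _⇒_ : Formula → Formula → Formula
  ⟦_⟧ : Set → Formula

infixr 5 _⇒_

¬' : Formula → Formula
¬' φ = φ ⇒ ⊥'

⊤' : Formula
⊤' = ¬' ⊥'

_∨'_ : Formula → Formula → Formula
φ ∨' ψ = ¬' φ ⇒ ψ

_∧'_ : Formula → Formula → Formula
φ ∧' ψ = ¬' (φ ⇒ ¬' ψ)

⋁ : List Formula → Formula
⋁ []       = ⊥'
⋁ (φ ∷ φs) = φ ∨' ⋁ φs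

⋀ : List Formula → Formula
⋀ []       = ⊤'
⋀ (φ ∷ φs) = φ ∧' ⋀ φs

-- Truth of a formula in the model r (r makes exactly Y_r true).
_⊨_ : R → Formula → Set
r ⊨ Y s     = r ≡ s
r ⊨ ⊥'      = E.⊥
r ⊨ (φ ⇒ ψ) = r ⊨ φ → r ⊨ ψ
r ⊨ ⟦ S ⟧   = S

Ax₁ : Formula
Ax₁ = ⋁ (map Y (allFin 6))
   ∧' ⋀ (concatMap (λ r → concatMap (λ s →
          if ⌊ r <ᶠ? s ⌋ then (¬' (Y r) ∨' ¬' (Y s)) ∷ [] else []) (allFin 6)) (allFin 6))

record AxiomSystem : Set₁ where
  field
    Idx    : Set
    axiom  : Idx → Formula
    hasAx₁ : Σ[ i ∈ Idx ] axiom i ≡ Ax₁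
open AxiomSystem public

_⊢_ : AxiomSystem → Formula → Set
A ⊢ φ = ∀ (r : R) → (∀ i → r ⊨ axiom A i) → r ⊨ φ

⟨T∈_⟩ : SubR → Formula
⟨T∈ B ⟩ = ⋁ (concatMap (λ r → if lookup B r then Y r ∷ [] else []) (allFin 6))

≤set : R → SubR
≤set d = tabulate (λ r → ⌊ toℕ r ≤? toℕ d ⌋)

⟨T≤_⟩ : R → Formula
⟨T≤ d ⟩ = ⟨T∈ ≤set d ⟩

Dset : SubR
Dset = tabulate (λ r → ⌊ toℕ r <? 5 ⌋)

_∈K_ : R → AxiomSystem → Set
d ∈K A = ∀ (K : SubR) → A ⊢ ⟨T∈ K ⟩ → d ∈R K

Surprising : AxiomSystem → Day → Set
Surprising A d = (day d ∈K A) × ¬ (A ⊢ ⟨T≤ day d ⟩)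

-- K - {max K} (with ∅ - {max ∅} = ∅); index 0 = Mo is the least element.
anyTrue : ∀ {n} → Vec Bool n → Bool
anyTrue []      = false
anyTrue (b ∷ v) = b ∨ anyTrue v

removeMax : ∀ {n} → Vec Bool n → Vec Bool n
removeMax []      = []
removeMax (b ∷ v) = if anyTrue v then b ∷ removeMax v else false ∷ v

allSubsets : ∀ n → List (Vec Bool n)
allSubsets zero    = [] ∷ []
allSubsets (suc n) = map (true ∷_) (allSubsets n) ++ map (false ∷_) (allSubsets n)

KA⊆ : AxiomSystem → SubR → Set
KA⊆ A K = ∀ (r : R) → r ∈K A → r ∈R K

σ : AxiomSystem → Formula
σ A = ⋀ (map (λ K → ⟦ KA⊆ A K ⟧ ⇒ ⟨T∈ removeMax K ⟩) (allSubsets 6))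

{-# OPTIONS --safe #-}
module Submission where

-- Backward induction from Fr: if every model of A lies at or before a day d ≥ Tu, then A proves
-- ⟨T ≤ d⟩, so the hypothesis makes d itself impossible and every model lies strictly before d.
-- Hence A forces T = Mo. Then A proves ⟨T ≤ d⟩ for every d, so no day is surprising; and {Mo}
-- is a knowledge set, so the conjunct of σ^A for K = {Mo} demands T ∈ ∅.

open import Defs
open import Data.Nat using (_≤_; _≤?_; z≤n; s≤s)
open import Data.Fin using (Fin; toℕ; zero; suc; fromℕ; inject₁) renaming (_≤_ to _≤ᶠ_)
open import Data.Fin.Properties using (≤-trans; ≤∧≢⇒<; <⇒≤pred; ≤fromℕ)
open import Data.Fin.Induction using (>-weakInduction)
open import Data.Bool using (Bool; true; false; if_then_else_)
open import Data.Vec using (Vec; []; _∷_; lookup)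
open import Data.Vec.Properties using (lookup∘tabulate)
open import Data.List using (List; []; _∷_; map; concatMap; allFin)
open import Data.List.Relation.Unary.Any using (Any; here; there)
open import Data.List.Relation.Unary.Any.Properties using (++⁺ʳ)
open import Data.List.Membership.Propositional using (_∈_)
open import Data.List.Membership.Propositional.Properties using (∈-++⁺ˡ; ∈-++⁺ʳ; ∈-map⁺; ∈-allFin)
open import Data.Product using (_×_; _,_)
open import Relation.Nullary using (¬_)
open import Relation.Nullary.Decidable using (⌊_⌋; does; isYes≗does; dec-true)
open import Data.Empty using (⊥-elim)
open import Relation.Binary.PropositionalEquality using (_≡_; refl; module ≡-Reasoning)

Mo none : R
Mo   = zero
none = fromℕ 5

⊨⋁⁺ : ∀ {r} (φs : List Formula) → Any (r ⊨_) φs → r ⊨ ⋁ φs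
⊨⋁⁺ (φ ∷ φs) (here r⊨φ)  r⊭φ = ⊥-elim (r⊭φ r⊨φ)
⊨⋁⁺ (φ ∷ φs) (there r⊨φs) _  = ⊨⋁⁺ φs r⊨φs

⊨⋀⁻ : ∀ {r φ} (φs : List Formula) → φ ∈ φs → r ⊨ ⋀ φs → ¬ ¬ (r ⊨ φ)
⊨⋀⁻ (φ ∷ φs) (here refl) r⊨⋀ r⊭φ = r⊨⋀ λ r⊨φ _ → r⊭φ r⊨φ
⊨⋀⁻ (φ ∷ φs) (there φ∈φs) r⊨⋀ r⊭φ = r⊨⋀ λ _ r⊨φs → ⊨⋀⁻ φs φ∈φs r⊨φs r⊭φ

⊨⟨T∈⟩ : ∀ {r} (B : SubR) → r ∈R B → r ⊨ ⟨T∈ B ⟩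
⊨⟨T∈⟩ {r} B r∈B = ⊨⋁⁺ _ (selected (allFin 6) (∈-allFin r))
  where
  selected : (rs : List R) → r ∈ rs →
             Any (r ⊨_) (concatMap (λ s → if lookup B s then Y s ∷ [] else []) rs)
  selected (s ∷ rs) (here refl) rewrite r∈B = here refl
  selected (s ∷ rs) (there r∈rs) =
    ++⁺ʳ (if lookup B s then Y s ∷ [] else []) (selected rs r∈rs)

∈-allSubsets : ∀ {n} (K : Vec Bool n) → K ∈ allSubsets n
∈-allSubsets []          = here refl
∈-allSubsets (true ∷ K)  = ∈-++⁺ˡ (∈-map⁺ (true ∷_) (∈-allSubsets K))
∈-allSubsets (false ∷ K) =
  ∈-++⁺ʳ (map (true ∷_) (allSubsets _)) (∈-map⁺ (false ∷_) (∈-allSubsets K))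

∈≤set : ∀ {r d} → r ≤ᶠ d → r ∈R ≤set d
∈≤set {r} {d} r≤d = begin
  lookup (≤set d) r         ≡⟨ lookup∘tabulate (λ s → ⌊ toℕ s ≤? toℕ d ⌋) r ⟩
  ⌊ toℕ r ≤? toℕ d ⌋        ≡⟨ isYes≗does (toℕ r ≤? toℕ d) ⟩
  does (toℕ r ≤? toℕ d)     ≡⟨ dec-true (toℕ r ≤? toℕ d) r≤d ⟩
  true                      ∎
  where open ≡-Reasoning

Model : AxiomSystem → R → Set
Model A r = ∀ i → r ⊨ axiom A i

ModelsAtMost : AxiomSystem → R → Set
ModelsAtMost A d = ∀ m → Model A m → m ≤ᶠ d

module _ (A : AxiomSystem) where

  ⊢⟨T≤⟩ : ∀ d → ModelsAtMost A d → A ⊢ ⟨T≤ d ⟩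
  ⊢⟨T≤⟩ d m≤d m ⊨A = ⊨⟨T∈⟩ (≤set d) (∈≤set (m≤d m ⊨A))

  modelsAtMost-pred : ∀ {d : Fin 5} → ModelsAtMost A (suc d) → ¬ Model A (suc d) →
                      ModelsAtMost A (inject₁ d)
  modelsAtMost-pred m≤d ⊭d m ⊨A = <⇒≤pred (≤∧≢⇒< (m≤d m ⊨A) λ { refl → ⊭d ⊨A })

  ¬Model-if-excluded : ∀ {d} → A ⊢ (⟦ A ⊢ ⟨T≤ d ⟩ ⟧ ⇒ ¬' (Y d)) →
                       ModelsAtMost A d → ¬ Model A d
  ¬Model-if-excluded ⊢excl m≤d ⊨A = ⊢excl _ ⊨A (⊢⟨T≤⟩ _ m≤d) refl

  KA⊆-knowledgeSet : ∀ K → A ⊢ ⟨T∈ K ⟩ → KA⊆ A K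
  KA⊆-knowledgeSet K ⊢K r r∈KA = r∈KA K ⊢K

  ⊨σ⁻ : ∀ {r} K → r ⊨ σ A → KA⊆ A K → ¬ ¬ (r ⊨ ⟨T∈ removeMax K ⟩)
  ⊨σ⁻ K r⊨σ KA⊆K r⊭K⁻ =
    ⊨⋀⁻ _ (∈-map⁺ conjunct (∈-allSubsets K)) r⊨σ λ r⊨conjunct → r⊭K⁻ (r⊨conjunct KA⊆K)
    where
    conjunct : SubR → Formula
    conjunct K = ⟦ KA⊆ A K ⟧ ⇒ ⟨T∈ removeMax K ⟩

  -- ≤set Mo = {Mo}, whose removeMax is ∅, and ⟨T ∈ ∅⟩ computes to ⊥.
  ⊭σ : KA⊆ A (≤set Mo) → ∀ r → ¬ (r ⊨ σ A)
  ⊭σ KA⊆Mo r r⊨σ = ⊨σ⁻ (≤set Mo) r⊨σ KA⊆Mo λ ()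

modelsAtMost-Mo : (A : AxiomSystem)
  → A ⊢ ⟨T∈ Dset ⟩
  → (∀ (d : Day) → 1 ≤ toℕ d → A ⊢ (⟦ A ⊢ ⟨T≤ day d ⟩ ⟧ ⇒ ¬' (Y (day d))))
  → ModelsAtMost A Mo
modelsAtMost-Mo A ⊢D ⊢excl = >-weakInduction (λ d → ModelsAtMost A (day d)) atMost-Fr step zero
  where
  ¬Model-none : ¬ Model A none
  ¬Model-none ⊨A = ⊢D none ⊨A (λ ()) (λ ()) (λ ()) (λ ()) (λ ())

  atMost-Fr : ModelsAtMost A (day (fromℕ 4))
  atMost-Fr = modelsAtMost-pred A (λ m _ → ≤fromℕ m) ¬Model-none

  step : ∀ d → ModelsAtMost A (day (suc d)) → ModelsAtMost A (day (inject₁ d))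
  step d m≤d =
    modelsAtMost-pred A {d = inject₁ d} m≤d (¬Model-if-excluded A (⊢excl (suc d) (s≤s z≤n)) m≤d)

proposition4p1 : (A : AxiomSystem)
    → A ⊢ ⟨T∈ Dset ⟩
    → (∀ (d : Day) → 1 ≤ toℕ d → A ⊢ (⟦ A ⊢ ⟨T≤ day d ⟩ ⟧ ⇒ ¬' (Y (day d))))
    → (∀ (d : Day) → ¬ Surprising A d) × (∀ (d : Day) → ¬ (day d ⊨ σ A))
proposition4p1 A ⊢D ⊢excl = not-surprising , λ d → ⊭σ A KA⊆Mo (day d)
  where
  atMost-Mo : ModelsAtMost A Mo
  atMost-Mo = modelsAtMost-Mo A ⊢D ⊢excl

  not-surprising : ∀ d → ¬ Surprising A d
  not-surprising d (_ , ⊬T≤d) = ⊬T≤d (⊢⟨T≤⟩ A (day d) λ m ⊨A → ≤-trans (atMost-Mo m ⊨A) z≤n)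

  KA⊆Mo : KA⊆ A (≤set Mo)
  KA⊆Mo = KA⊆-knowledgeSet A (≤set Mo) (⊢⟨T≤⟩ A Mo atMost-Mo)
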